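{- For all $d\ge 2$ and $n\ge 1$, $$\mathrm{Sep}_n^{d-1} = S_n(2413,3142)^{d-1}\cap S_n^{d-1}(\mathrm{Sym}((132,213))),$$ i.e. a $d$-permutation $(\sigma_1,\dots,\sigma_{d-1})$ of size $n$ is separable if and only if each $\sigma_i$ avoids the classical patterns $2413$ and $3142$ and $(\sigma_1,\dots,\sigma_{d-1})$ avoids every $3$-dimensional pattern in $\mathrm{Sym}((132,213))$.
   Context: A $d$-permutation of size $n$ is a tuple $\boldsymbol\sigma=(\sigma_1,\dots,\sigma_{d-1})$ of permutations of $[n]$; set $\bar\sigma_1=\mathrm{Id}_n$ and $\bar\sigma_{i}=\sigma_{i-1}$ for $2\le i\le d$. Its diagram is $\{(\bar\sigma_1(i),\dots,\bar\sigma_d(i)) : i\in[n]\}$. For permutations $\sigma$ of size $n$ and $\pi$ of size $k$: $\sigma\oplus\pi=\sigma(1),\dots,\sigma(n),\pi(1)+n,\dots,\pi(k)+n$ and $\sigma\ominus\pi=\sigma(1)+k,\dots,\sigma(n)+k,\pi(1),\dots,\pi(k)$. A direction is a word $\mathbf e\in\{+,-\}^d$ with $e_1=+$. The $d$-sum of $d$-permutations $\boldsymbol\sigma,\boldsymbol\pi$ w.r.t. $\mathbf e$ is the $d$-permutation $(\bar\sigma_2\oplus_2\bar\pi_2,\dots,\bar\sigma_d\oplus_d\bar\pi_d)$ where $\oplus_i$ is $\oplus$ if $e_i=+$ and $\ominus$ if $e_i=-$. A $d$-permutation is separable if it has size $1$ or is a $d$-sum of two separable $d$-permutations; $\mathrm{Sep}_n^{d-1}$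 is the set of separable $d$-permutations of size $n$. $S_n(2413,3142)^{d-1}$ is the set of $(d-1)$-tuples of permutations each avoiding the classical patterns $2413$ and $3142$. Pattern containment: for an increasing index sequence $i_1<\dots<i_{d'}$ in $[d]$, the direct projection of $\boldsymbol\sigma$ is the $d'$-permutation with diagram $\{(p_{i_1},\dots,p_{i_{d'}}): p \in P_{\boldsymbol\sigma}\}$; $\boldsymbol\sigma$ contains a $d'$-dimensional pattern $\boldsymbol\pi$ if some direct projection of dimension $d'$ has a subset of its diagram whose standardization (same relative order in each coordinate, on a grid $[k]^{d'}$) is the diagram of $\boldsymbol\pi$. $S_n^{d-1}(\Pi)$ is the set of $d$-permutations of size $n$ avoiding all patterns of $\Pi$. $(132,213)$ is the $3$-permutation with $\sigma_1=132$, $\sigma_2=213$; for a $3\times3$ signed permutation matrix $s$, $s(\boldsymbol\pi)$ is the $3$-permutation whose diagram is the standardization of $\{sp: p\in P_{\boldsymbol\pi}\}$, and $\mathrm{Sym}((132,213))$ is the set of all $s((132,213))$ (it has 8 elements). -}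

module Defs where

open import Data.Nat as ℕ using (ℕ; zero; suc; _+_; pred)
open import Data.Nat.Properties using (+-comm)
open import Data.Fin as Fin using (Fin; zero; suc; _↑ˡ_; _↑ʳ_; splitAt; cast; opposite; #_; _<_)
open import Data.Sum using (_⊎_; inj₁; inj₂; [_,_]′)
open import Data.Product using (Σ; _×_; _,_)
open import Data.Vec using (Vec; []; _∷_; lookup)
open import Relation.Binary.PropositionalEquality using (_≡_)
open import Function using (id; _∘_)
open import Function.Bundles using (_⇔_)
open import Function.Definitions using (Bijective)
open import Relation.Nullary using (¬_)

-- Permutations of [n] (encoded as Fin n, i.e. 0-indexed)

RawPerm : ℕ → Set
RawPerm n = Fin n → Fin n

IsPerm : ∀ {n} → RawPerm n → Set
IsPerm f = Bijective _≡_ _≡_ f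

_⊕_ : ∀ {a b} → RawPerm a → RawPerm b → RawPerm (a + b)
_⊕_ {a} {b} σ π i = [ (λ x → σ x ↑ˡ b) , (λ y → a ↑ʳ π y) ]′ (splitAt a i)

_⊖_ : ∀ {a b} → RawPerm a → RawPerm b → RawPerm (a + b)
_⊖_ {a} {b} σ π i =
  [ (λ x → cast (+-comm b a) (b ↑ʳ σ x)) , (λ y → cast (+-comm b a) (π y ↑ˡ a)) ]′ (splitAt a i)

data Sign : Set where
  plus minus : Sign

signedSum : ∀ {a b} → Sign → RawPerm a → RawPerm b → RawPerm (a + b)
signedSum plus  σ π = σ ⊕ π
signedSum minus σ π = σ ⊖ π

-- d-permutations.  For d ≥ 2 the coordinates are indexed by
-- Fin (suc (pred d)) (which is Fin d), the tuple (σ₁,…,σ_{d-1}) by Fin (pred d).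

record DPerm (d n : ℕ) : Set where
  constructor dperm
  field
    comp : Fin (pred d) → RawPerm n

open DPerm public

IsDPerm : ∀ {d n} → DPerm d n → Set
IsDPerm σ = ∀ i → IsPerm (comp σ i)

bar : ∀ {d n} → DPerm d n → Fin (suc (pred d)) → RawPerm n
bar σ zero    = id
bar σ (suc i) = comp σ i

Direction : ℕ → Set
Direction d = Σ (Fin (suc (pred d)) → Sign) (λ e → e zero ≡ plus)

dsum : ∀ {d a b} → Direction d → DPerm d a → DPerm d b → DPerm d (a + b)
dsum (e , _) σ π = dperm λ i → signedSum (e (suc i)) (bar σ (suc i)) (bar π (suc i))

-- separable d-permutations (equality of tuples = pointwise equality)
data Separable {d : ℕ} : (n : ℕ) → DPerm d n → Set where
  sep-one : (σ : DPerm d 1) → IsDPerm σ → Separable 1 σ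
  sep-sum : ∀ {a b} (e : Direction d) {σ : DPerm d a} {π : DPerm d b} →
            Separable a σ → Separable b π →
            (τ : DPerm d (a + b)) → (∀ i x → comp τ i x ≡ comp (dsum e σ π) i x) →
            Separable (a + b) τ

ContainsClassical : ∀ {n k} → RawPerm n → RawPerm k → Set
ContainsClassical {n} {k} σ p =
  Σ (Fin k → Fin n) λ f →
    (∀ j j' → j < j' → f j < f j') ×
    (∀ j j' → (p j < p j') ⇔ (σ (f j) < σ (f j')))

AvoidsClassical : ∀ {n k} → RawPerm n → RawPerm k → Set
AvoidsClassical σ p = ¬ ContainsClassical σ p

p2413 : RawPerm 4
p2413 = lookup (# 1 ∷ # 3 ∷ # 0 ∷ # 2 ∷ [])

p3142 : RawPerm 4
p3142 = lookup (# 2 ∷ # 0 ∷ # 3 ∷ # 1 ∷ [])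

-- A diagram of size k in dimension D is given as a family of k points,
-- point j having coordinates (P c j)_{c : Fin D}.  The diagram of a
-- d-permutation σ is the family j ↦ (σ̄_c(j))_c, i.e. `bar σ`.
-- σ contains the diagram P if for some increasing index sequence ι
-- the direct projection of σ's diagram has a subset (points g j) whose
-- standardization is P, i.e. which is coordinatewise order-isomorphic to P.

ContainsDiagram : ∀ {d n D k} → DPerm d n → (Fin D → Fin k → Fin k) → Set
ContainsDiagram {d} {n} {D} {k} σ P =
  Σ (Fin D → Fin (suc (pred d))) λ ι →
    (∀ a b → a < b → ι a < ι b) ×
    Σ (Fin k → Fin n) λ g →
      ∀ c j j' → (P c j < P c j') ⇔ (bar σ (ι c) (g j) < bar σ (ι c) (g j'))

ContainsPattern : ∀ {d n d' k} → DPerm d n → DPerm d' k → Set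
ContainsPattern σ π = ContainsDiagram σ (bar π)

-- Symmetries: 3×3 signed permutation matrices s, row r having the entry
-- sign r at column perm r, so (s p)_r = sign r · p_{perm r}.

record SignedPerm3 : Set where
  field
    perm   : Fin 3 → Fin 3
    isPerm : IsPerm perm
    sign   : Fin 3 → Sign

-- standardization of a coordinate multiplied by a sign: identity for +,
-- reversal (k-1-x) for -.
applySign : ∀ {k} → Sign → Fin k → Fin k
applySign plus  x = x
applySign minus x = opposite x

-- the diagram of s(π) (standardization of {s p : p ∈ P_π}) for a 3-permutation π
symDiagram : ∀ {k} → SignedPerm3 → DPerm 3 k → (Fin 3 → Fin k → Fin k)
symDiagram s π r j = applySign (SignedPerm3.sign s r) (bar π (SignedPerm3.perm s r) j)

p132-213 : DPerm 3 3
p132-213 = dperm (lookup (lookup (# 0 ∷ # 2 ∷ # 1 ∷ []) ∷ lookup (# 1 ∷ # 0 ∷ # 2 ∷ []) ∷ []))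

AvoidsSym132-213 : ∀ {d n} → DPerm d n → Set
AvoidsSym132-213 σ = (s : SignedPerm3) → ¬ ContainsDiagram σ (symDiagram s p132-213)

module Submission where

-- A pattern is inseparable when no bipartition of its points has one part entirely
-- below the other in every coordinate.  An occurrence of a pattern in a d-sum either
-- lies inside one summand or is cut by the sum into such a bipartition, so separable
-- d-permutations avoid every inseparable pattern; 2413, 3142 and the symmetries of
-- (132,213) are inseparable by a finite check.
--
-- Conversely, colour each pair x < y by the set of coordinates i with σᵢ(x) < σᵢ(y).
-- Avoiding Sym((132,213)) gives col(p,r) ∈ {col(p,q), col(q,r)} for p < q < r, and
-- avoiding 2413 and 3142 in each σᵢ excludes four points whose six pairs alternate
-- between two colours.  These two rules force a split point k such that all pairs
-- straddling k share one colour, and that colour exhibits σ as a d-sum of its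
-- restrictions to both sides, which again satisfy the rules.

open import Defs
open import Data.Bool as Bool using (Bool; true; false; if_then_else_)
import Data.Bool.Properties as BoolP
open import Data.Empty using (⊥; ⊥-elim)
open import Data.Unit using (⊤; tt)
open import Data.Fin as F using (Fin; zero; suc; toℕ; fromℕ<; _↑ˡ_; _↑ʳ_; splitAt; opposite)
import Data.Fin.Properties as FP
open import Data.Nat as ℕ using (ℕ; zero; suc; _+_; _∸_; pred; z≤n; s≤s; _≤_)
import Data.Nat.Properties as NP
open import Data.Nat.Induction using (<-rec)
open import Data.Product using (Σ; ∃; _,_; proj₁; proj₂; _×_)
open import Data.Sum using (_⊎_; inj₁; inj₂) renaming ([_,_]′ to either)
open import Data.Vec using (Vec; []; _∷_; lookup; tabulate)
import Data.Vec.Properties as VP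
open import Function using (_∘_)
open import Function.Bundles using (_⇔_; mk⇔; Equivalence)
open import Function.Definitions using (Injective)
open import Function.Properties.Equivalence using () renaming (trans to ⇔-trans)
open import Relation.Binary.Definitions using (DecidableEquality; tri<; tri≈; tri>)
open import Relation.Binary.PropositionalEquality
open import Relation.Nullary using (¬_; Dec; yes; no; does)
open import Relation.Nullary.Decidable using (dec-true; dec-false; from-yes; ¬?; _×-dec_; _⊎-dec_; _→-dec_)

private
  variable
    d k n D : ℕ

StrictlyIncreasing : ∀ {k n} → (Fin k → Fin n) → Set
StrictlyIncreasing f = ∀ j j' → j F.< j' → f j F.< f j'

strictlyIncreasing⇒injective : {f : Fin k → Fin n} → StrictlyIncreasing f → Injective _≡_ _≡_ f
strictlyIncreasing⇒injective {f = f} inc {j} {j'} fj≡fj' with FP.<-cmp j j'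
... | tri< j<j' _ _ = ⊥-elim (FP.<⇒≢ (inc j j' j<j') fj≡fj')
... | tri≈ _ j≡j' _ = j≡j'
... | tri> _ _ j'<j = ⊥-elim (FP.<⇒≢ (inc j' j j'<j) (sym fj≡fj'))

strictlyIncreasing⇒<-⇔ : {f : Fin k → Fin n} → StrictlyIncreasing f → ∀ j j' → (j F.< j') ⇔ (f j F.< f j')
strictlyIncreasing⇒<-⇔ {f = f} inc j j' = mk⇔ (inc j j') reflect
  where
  reflect : f j F.< f j' → j F.< j'
  reflect fj<fj' with FP.<-cmp j j'
  ... | tri< j<j' _ _ = j<j'
  ... | tri≈ _ refl _ = ⊥-elim (FP.<-irrefl refl fj<fj')
  ... | tri> _ _ j'<j = ⊥-elim (FP.<-asym fj<fj' (inc j' j j'<j))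

≮∧≢⇒> : {x y : Fin n} → ¬ (x F.< y) → x ≢ y → y F.< x
≮∧≢⇒> {x = x} {y} x≮y x≢y with FP.<-cmp x y
... | tri< x<y _ _ = ⊥-elim (x≮y x<y)
... | tri≈ _ x≡y _ = ⊥-elim (x≢y x≡y)
... | tri> _ _ y<x = y<x

<-pairs : {R : Fin (suc k) → Fin (suc k) → Set} →
  (∀ j → R zero (suc j)) → (∀ j j' → j F.< j' → R (suc j) (suc j')) →
  ∀ j j' → j F.< j' → R j j'
<-pairs first rest zero    (suc j') _          = first j'
<-pairs first rest (suc j) (suc j') (s≤s j<j') = rest j j' j<j'

no-pairs : {R : Fin 1 → Fin 1 → Set} → ∀ j j' → j F.< j' → R j j'
no-pairs zero zero ()

opposite-< : {x y : Fin n} → x F.< y → opposite y F.< opposite x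
opposite-< {x = x} {y} x<y = subst₂ ℕ._<_ (sym (FP.opposite-prop y)) (sym (FP.opposite-prop x))
  (NP.∸-monoʳ-< (s≤s x<y) (FP.toℕ<n y))

opposite-injective : Injective _≡_ _≡_ (opposite {n})
opposite-injective {x = x} {y} e =
  trans (sym (FP.opposite-involutive x)) (trans (cong opposite e) (FP.opposite-involutive y))

opposite-<⁻¹ : {x y : Fin n} → opposite x F.< opposite y → y F.< x
opposite-<⁻¹ {n} {x} {y} h = NP.≤-pred (NP.∸-cancelʳ-< {m = suc (toℕ x)} {n = suc (toℕ y)} {o = n}
  (subst₂ ℕ._<_ (FP.opposite-prop x) (FP.opposite-prop y) h))

_<ᵇ_ : Fin n → Fin n → Bool
x <ᵇ y = does (x F.<? y)

does-true : ∀ {A : Set} (a? : Dec A) → does a? ≡ true → A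
does-true (yes a) _  = a
does-true (no _)  ()

does-false : ∀ {A : Set} (a? : Dec A) → does a? ≡ false → ¬ A
does-false (yes _) ()
does-false (no ¬a) _ = ¬a

<ᵇ⇒< : {x y : Fin n} → x <ᵇ y ≡ true → x F.< y
<ᵇ⇒< {x = x} {y} = does-true (x F.<? y)

<ᵇ≡false⇒≮ : {x y : Fin n} → x <ᵇ y ≡ false → ¬ (x F.< y)
<ᵇ≡false⇒≮ {x = x} {y} = does-false (x F.<? y)

<⇒<ᵇ : {x y : Fin n} → x F.< y → x <ᵇ y ≡ true
<⇒<ᵇ {x = x} {y} = dec-true (x F.<? y)

≮⇒<ᵇ≡false : {x y : Fin n} → ¬ (x F.< y) → x <ᵇ y ≡ false
≮⇒<ᵇ≡false {x = x} {y} = dec-false (x F.<? y)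

<ᵇ-≡⇒<-⇔ : ∀ {m} {x y : Fin n} {x' y' : Fin m} → x <ᵇ y ≡ x' <ᵇ y' → (x F.< y ⇔ x' F.< y')
<ᵇ-≡⇒<-⇔ e = mk⇔ (λ h → <ᵇ⇒< (trans (sym e) (<⇒<ᵇ h))) (λ h → <ᵇ⇒< (trans e (<⇒<ᵇ h)))

<ᵇ-shift : ∀ {m} (o : ℕ) {x y : Fin n} {x' y' : Fin m} →
  toℕ x' ≡ o + toℕ x → toℕ y' ≡ o + toℕ y → x' <ᵇ y' ≡ x <ᵇ y
<ᵇ-shift o {x} {y} ex ey with x <ᵇ y in x<ᵇy
... | true  = <⇒<ᵇ (subst₂ ℕ._<_ (sym ex) (sym ey) (NP.+-monoʳ-< o (<ᵇ⇒< x<ᵇy)))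
... | false = ≮⇒<ᵇ≡false λ h → <ᵇ≡false⇒≮ x<ᵇy (NP.+-cancelˡ-< o _ _ (subst₂ ℕ._<_ ex ey h))

<-⇔-from-bits : ∀ {m m'} (f : Fin k → Fin m) (g : Fin k → Fin m') →
  Injective _≡_ _≡_ f → Injective _≡_ _≡_ g →
  (∀ j j' → j F.< j' → f j <ᵇ f j' ≡ g j <ᵇ g j') → ∀ j j' → (f j F.< f j') ⇔ (g j F.< g j')
<-⇔-from-bits f g f-inj g-inj bits j j' with FP.<-cmp j j'
... | tri< j<j' _ _ = <ᵇ-≡⇒<-⇔ (bits j j' j<j')
... | tri≈ _ refl _ = mk⇔ (⊥-elim ∘ FP.<-irrefl refl) (⊥-elim ∘ FP.<-irrefl refl)
... | tri> _ _ j'<j = mk⇔ (flip g-inj (Equivalence.from reversed)) (flip f-inj (Equivalence.to reversed))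
  where
  reversed = <ᵇ-≡⇒<-⇔ (bits j' j j'<j)
  j'≢j : j' ≢ j
  j'≢j = FP.<⇒≢ j'<j
  flip : ∀ {m m″} {h : Fin _ → Fin m} {h' : Fin _ → Fin m″} → Injective _≡_ _≡_ h' →
    (h' j' F.< h' j → h j' F.< h j) → h j F.< h j' → h' j F.< h' j'
  flip h'-inj back hj<hj' = ≮∧≢⇒> (λ h'j'<h'j → FP.<-asym hj<hj' (back h'j'<h'j)) (j'≢j ∘ h'-inj)

leftOffset : ℕ → Sign → ℕ
leftOffset b plus  = 0
leftOffset b minus = b

rightOffset : ℕ → Sign → ℕ
rightOffset a plus  = a
rightOffset a minus = 0

signedSum-↑ˡ : ∀ {a b} sg (σ : RawPerm a) (π : RawPerm b) x →
  toℕ (signedSum sg σ π (x ↑ˡ b)) ≡ leftOffset b sg + toℕ (σ x)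
signedSum-↑ˡ {a} {b} plus σ π x rewrite FP.splitAt-↑ˡ a x b = FP.toℕ-↑ˡ (σ x) b
signedSum-↑ˡ {a} {b} minus σ π x rewrite FP.splitAt-↑ˡ a x b =
  trans (FP.toℕ-cast (NP.+-comm b a) (b ↑ʳ σ x)) (FP.toℕ-↑ʳ b (σ x))

signedSum-↑ʳ : ∀ {a b} sg (σ : RawPerm a) (π : RawPerm b) y →
  toℕ (signedSum sg σ π (a ↑ʳ y)) ≡ rightOffset a sg + toℕ (π y)
signedSum-↑ʳ {a} {b} plus σ π y rewrite FP.splitAt-↑ʳ a b y = FP.toℕ-↑ʳ a (π y)
signedSum-↑ʳ {a} {b} minus σ π y rewrite FP.splitAt-↑ʳ a b y =
  trans (FP.toℕ-cast (NP.+-comm b a) (π y ↑ˡ a)) (FP.toℕ-↑ˡ (π y) a)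

data BlockView (a b : ℕ) : Fin (a + b) → Set where
  left  : (x : Fin a) → BlockView a b (x ↑ˡ b)
  right : (y : Fin b) → BlockView a b (a ↑ʳ y)

blockView : ∀ a b (i : Fin (a + b)) → BlockView a b i
blockView a b i with splitAt a i in eq
... | inj₁ x = subst (BlockView a b) (FP.splitAt⁻¹-↑ˡ eq) (left x)
... | inj₂ y = subst (BlockView a b) (FP.splitAt⁻¹-↑ʳ eq) (right y)

signedSum-unique : ∀ {a b} sg (f : RawPerm (a + b)) (σ : RawPerm a) (π : RawPerm b) →
  (∀ x → toℕ (f (x ↑ˡ b)) ≡ leftOffset b sg + toℕ (σ x)) →
  (∀ y → toℕ (f (a ↑ʳ y)) ≡ rightOffset a sg + toℕ (π y)) →
  ∀ i → f i ≡ signedSum sg σ π i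
signedSum-unique {a} {b} sg f σ π f-left f-right i with blockView a b i
... | left x  = FP.toℕ-injective (trans (f-left x) (sym (signedSum-↑ˡ sg σ π x)))
... | right y = FP.toℕ-injective (trans (f-right y) (sym (signedSum-↑ʳ sg σ π y)))

module DSum {a b} (e : Direction d) (σ : DPerm d a) (π : DPerm d b) (τ : DPerm d (a + b))
  (τ≗σ+π : ∀ i x → comp τ i x ≡ comp (dsum e σ π) i x) where

  sign : Fin (suc (pred d)) → Sign
  sign = proj₁ e

  bar-↑ˡ : ∀ w x → toℕ (bar τ w (x ↑ˡ b)) ≡ leftOffset b (sign w) + toℕ (bar σ w x)
  bar-↑ˡ zero    x rewrite proj₂ e = FP.toℕ-↑ˡ x b
  bar-↑ˡ (suc i) x = trans (cong toℕ (τ≗σ+π i (x ↑ˡ b))) (signedSum-↑ˡ (sign (suc i)) (comp σ i) (comp π i) x)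

  bar-↑ʳ : ∀ w y → toℕ (bar τ w (a ↑ʳ y)) ≡ rightOffset a (sign w) + toℕ (bar π w y)
  bar-↑ʳ zero    y rewrite proj₂ e = FP.toℕ-↑ʳ a y
  bar-↑ʳ (suc i) y = trans (cong toℕ (τ≗σ+π i (a ↑ʳ y))) (signedSum-↑ʳ (sign (suc i)) (comp σ i) (comp π i) y)

  <-within-left : ∀ w x x' → (bar τ w (x ↑ˡ b) F.< bar τ w (x' ↑ˡ b)) ⇔ (bar σ w x F.< bar σ w x')
  <-within-left w x x' = <ᵇ-≡⇒<-⇔ (<ᵇ-shift (leftOffset b (sign w)) (bar-↑ˡ w x) (bar-↑ˡ w x'))

  <-within-right : ∀ w y y' → (bar τ w (a ↑ʳ y) F.< bar τ w (a ↑ʳ y')) ⇔ (bar π w y F.< bar π w y')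
  <-within-right w y y' = <ᵇ-≡⇒<-⇔ (<ᵇ-shift (rightOffset a (sign w)) (bar-↑ʳ w y) (bar-↑ʳ w y'))

  <-across : ∀ w x y → sign w ≡ plus → bar τ w (x ↑ˡ b) F.< bar τ w (a ↑ʳ y)
  <-across w x y sw≡plus = subst₂ ℕ._<_ (sym (bar-↑ˡ w x)) (sym (bar-↑ʳ w y))
    (subst (λ s → leftOffset b s + toℕ (bar σ w x) ℕ.< rightOffset a s + toℕ (bar π w y)) (sym sw≡plus)
      (NP.<-≤-trans (FP.toℕ<n (bar σ w x)) (NP.m≤m+n a _)))

  >-across : ∀ w x y → sign w ≡ minus → bar τ w (a ↑ʳ y) F.< bar τ w (x ↑ˡ b)
  >-across w x y sw≡minus = subst₂ ℕ._<_ (sym (bar-↑ʳ w y)) (sym (bar-↑ˡ w x))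
    (subst (λ s → rightOffset a s + toℕ (bar π w y) ℕ.< leftOffset b s + toℕ (bar σ w x)) (sym sw≡minus)
      (NP.<-≤-trans (FP.toℕ<n (bar π w y)) (NP.m≤m+n b _)))

Diagram : ℕ → ℕ → Set
Diagram D k = Fin D → Fin k → Fin k

Separates : (Fin k → Fin k) → (Fin k → Bool) → Set
Separates R S = (∀ j j' → S j ≡ true → S j' ≡ false → R j F.< R j')
              ⊎ (∀ j j' → S j ≡ true → S j' ≡ false → R j' F.< R j)

Splits : Diagram D k → (Fin k → Bool) → Set
Splits P S = ∃ (λ j → S j ≡ true) × ∃ (λ j → S j ≡ false) × (∀ c → Separates (P c) S)

Inseparable : Diagram D k → Set
Inseparable P = ∀ S → ¬ Splits P S

Nonconstant : Diagram D k → Set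
Nonconstant P = ∃ λ c → ∃ λ j → ∃ λ j' → P c j ≢ P c j'

all-or-mixed : (S : Fin k → Bool) →
  (∀ j → S j ≡ true) ⊎ (∀ j → S j ≡ false) ⊎ (∃ (λ j → S j ≡ true) × ∃ (λ j → S j ≡ false))
all-or-mixed {k} S with FP.all? (λ j → S j Bool.≟ true) | FP.all? (λ j → S j Bool.≟ false)
... | yes all-true | _         = inj₁ all-true
... | no _         | yes all-false = inj₂ (inj₁ all-false)
... | no not-all-true | no not-all-false =
  inj₂ (inj₂ (witness true not-all-false , witness false not-all-true))
  where
  witness : ∀ b → ¬ (∀ j → S j ≡ Bool.not b) → ∃ λ j → S j ≡ b
  witness b ¬all with FP.¬∀⟶∃¬ k (λ j → S j ≡ Bool.not b) (λ j → S j Bool.≟ Bool.not b) ¬all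
  ... | j , Sj≢¬b = j , trans (BoolP.¬-not Sj≢¬b) (BoolP.not-involutive b)

occurrence-pullback : ∀ {a} {σ : DPerm d a} {τ : DPerm d n} (h : Fin a → Fin n) →
  (∀ w x x' → (bar τ w (h x) F.< bar τ w (h x')) ⇔ (bar σ w x F.< bar σ w x')) →
  {P : Diagram D k} → ((ι , _ , g , _) : ContainsDiagram τ P) →
  (g' : Fin k → Fin a) → (∀ j → h (g' j) ≡ g j) → ContainsDiagram σ P
occurrence-pullback {σ = σ} {τ} h h-order {P} (ι , ι-inc , g , P≅τ) g' hg'≗g = ι , ι-inc , g' , P≅σ
  where
  P≅σ : ∀ c j j' → (P c j F.< P c j') ⇔ (bar σ (ι c) (g' j) F.< bar σ (ι c) (g' j'))
  P≅σ c j j' = ⇔-trans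
    (subst₂ (λ u v → (P c j F.< P c j') ⇔ (bar τ (ι c) u F.< bar τ (ι c) v))
      (sym (hg'≗g j)) (sym (hg'≗g j')) (P≅τ c j j'))
    (h-order (ι c) (g' j) (g' j'))

fin1-unique : (x y : Fin 1) → x ≡ y
fin1-unique zero zero = refl

isLeft : ∀ {a b} {i : Fin (a + b)} → BlockView a b i → Bool
isLeft (left _)  = true
isLeft (right _) = false

fromLeft : ∀ {a b} {i : Fin (a + b)} (v : BlockView a b i) → isLeft v ≡ true → Σ (Fin a) λ x → x ↑ˡ b ≡ i
fromLeft (left x) _ = x , refl

fromRight : ∀ {a b} {i : Fin (a + b)} (v : BlockView a b i) → isLeft v ≡ false → Σ (Fin b) λ y → a ↑ʳ y ≡ i
fromRight (right y) _ = y , refl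

separable⇒avoids-inseparable : {σ : DPerm d n} → Separable n σ →
  {P : Diagram D k} → Inseparable P → Nonconstant P → ¬ ContainsDiagram σ P
separable⇒avoids-inseparable (sep-one σ _) {P} _ (c , j , j' , Pcj≢Pcj') (ι , _ , g , P≅σ)
  with FP.<-cmp (P c j) (P c j')
... | tri< lt _ _ = FP.<-irrefl (cong (bar σ (ι c)) (fin1-unique _ _)) (Equivalence.to (P≅σ c j j') lt)
... | tri≈ _ eq _ = Pcj≢Pcj' eq
... | tri> _ _ gt = FP.<-irrefl (cong (bar σ (ι c)) (fin1-unique _ _)) (Equivalence.to (P≅σ c j' j) gt)
separable⇒avoids-inseparable (sep-sum {a} {b} e {σ} {π} σ-sep π-sep τ τ≗σ+π) {P} P-insep P-nonconst
  occ@(ι , _ , g , P≅τ) with all-or-mixed (isLeft ∘ blockView a b ∘ g)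
... | inj₁ all-left = separable⇒avoids-inseparable σ-sep P-insep P-nonconst
  (occurrence-pullback (_↑ˡ b) <-within-left occ (proj₁ ∘ inLeft) (proj₂ ∘ inLeft))
  where
  open DSum e σ π τ τ≗σ+π
  inLeft : ∀ j → Σ (Fin a) λ x → x ↑ˡ b ≡ g j
  inLeft j = fromLeft (blockView a b (g j)) (all-left j)
... | inj₂ (inj₁ all-right) = separable⇒avoids-inseparable π-sep P-insep P-nonconst
  (occurrence-pullback (a ↑ʳ_) <-within-right occ (proj₁ ∘ inRight) (proj₂ ∘ inRight))
  where
  open DSum e σ π τ τ≗σ+π
  inRight : ∀ j → Σ (Fin b) λ y → a ↑ʳ y ≡ g j
  inRight j = fromRight (blockView a b (g j)) (all-right j)
... | inj₂ (inj₂ (some-left , some-right)) = P-insep S (some-left , some-right , separates)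
  where
  open DSum e σ π τ τ≗σ+π
  S : _ → Bool
  S = isLeft ∘ blockView a b ∘ g
  τ-order-across : ∀ c {j j'} → S j ≡ true → S j' ≡ false →
    (sign (ι c) ≡ plus → bar τ (ι c) (g j) F.< bar τ (ι c) (g j')) ×
    (sign (ι c) ≡ minus → bar τ (ι c) (g j') F.< bar τ (ι c) (g j))
  τ-order-across c {j} {j'} Sj Sj'
    with fromLeft (blockView a b (g j)) Sj | fromRight (blockView a b (g j')) Sj'
  ... | x , gj | y , gj' =
    (subst₂ (λ u v → bar τ (ι c) u F.< bar τ (ι c) v) gj gj' ∘ <-across (ι c) x y) ,
    (subst₂ (λ u v → bar τ (ι c) u F.< bar τ (ι c) v) gj' gj ∘ >-across (ι c) x y)
  separates : ∀ c → Separates (P c) S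
  separates c with sign (ι c) in sign≡
  ... | plus  = inj₁ λ j j' Sj Sj' →
    Equivalence.from (P≅τ c j j') (proj₁ (τ-order-across c Sj Sj') sign≡)
  ... | minus = inj₂ λ j j' Sj Sj' →
    Equivalence.from (P≅τ c j' j) (proj₂ (τ-order-across c Sj Sj') sign≡)

Splits-resp : {P : Diagram D k} {S S' : Fin k → Bool} → (∀ j → S j ≡ S' j) → Splits P S → Splits P S'
Splits-resp {P = P} {S} {S'} S≗S' ((j₁ , S₁) , (j₂ , S₂) , sep) =
  (j₁ , trans (sym (S≗S' j₁)) S₁) , (j₂ , trans (sym (S≗S' j₂)) S₂) , transport ∘ sep
  where
  transport : ∀ {R} → Separates R S → Separates R S'
  transport (inj₁ below) = inj₁ λ j j' Sj Sj' → below j j' (trans (S≗S' j) Sj) (trans (S≗S' j') Sj')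
  transport (inj₂ above) = inj₂ λ j j' Sj Sj' → above j j' (trans (S≗S' j) Sj) (trans (S≗S' j') Sj')

separates? : (R : Fin k → Fin k) (S : Fin k → Bool) → Dec (Separates R S)
separates? R S = all-marked-pairs? (λ j j' → R j F.<? R j') ⊎-dec all-marked-pairs? (λ j j' → R j' F.<? R j)
  where
  all-marked-pairs? : {Q : Fin _ → Fin _ → Set} → (∀ j j' → Dec (Q j j')) →
    Dec (∀ j j' → S j ≡ true → S j' ≡ false → Q j j')
  all-marked-pairs? Q? = FP.all? λ j → FP.all? λ j' →
    (S j Bool.≟ true) →-dec ((S j' Bool.≟ false) →-dec Q? j j')

splits? : (P : Diagram D k) (S : Fin k → Bool) → Dec (Splits P S)
splits? P S = FP.any? (λ j → S j Bool.≟ true) ×-dec FP.any? (λ j → S j Bool.≟ false)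
  ×-dec FP.all? (λ c → separates? (P c) S)

all-vectors? : {Q : Vec Bool k → Set} → (∀ v → Dec (Q v)) → Dec (∀ v → Q v)
all-vectors? {zero} Q? with Q? []
... | yes q  = yes λ { [] → q }
... | no ¬q  = no λ all → ¬q (all [])
all-vectors? {suc k} Q? with all-vectors? (Q? ∘ (true ∷_)) | all-vectors? (Q? ∘ (false ∷_))
... | yes qt | yes qf = yes λ { (true ∷ v) → qt v ; (false ∷ v) → qf v }
... | no ¬qt | _      = no λ all → ¬qt (all ∘ (true ∷_))
... | _      | no ¬qf = no λ all → ¬qf (all ∘ (false ∷_))

inseparable? : (P : Diagram D k) → Dec (∀ v → ¬ Splits P (lookup v))
inseparable? P = all-vectors? (λ v → ¬? (splits? P (lookup v)))

vectors⇒inseparable : {P : Diagram D k} → (∀ v → ¬ Splits P (lookup v)) → Inseparable P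
vectors⇒inseparable none S = none (tabulate S) ∘ Splits-resp (sym ∘ VP.lookup∘tabulate S)

classicalDiagram : RawPerm k → Diagram 2 k
classicalDiagram p zero    = λ j → j
classicalDiagram p (suc _) = p

inseparable-2413 : Inseparable (classicalDiagram p2413)
inseparable-2413 = vectors⇒inseparable (from-yes (inseparable? (classicalDiagram p2413)))

inseparable-3142 : Inseparable (classicalDiagram p3142)
inseparable-3142 = vectors⇒inseparable (from-yes (inseparable? (classicalDiagram p3142)))

nonconstant-classical : (p : RawPerm (suc (suc k))) → Nonconstant (classicalDiagram p)
nonconstant-classical p = zero , zero , suc zero , λ ()

Separates-applySign : ∀ sg {R : Fin k → Fin k} {S} → Separates (applySign sg ∘ R) S → Separates R S
Separates-applySign plus  sep          = sep
Separates-applySign minus (inj₁ below) = inj₂ λ j j' Sj Sj' → opposite-<⁻¹ (below j j' Sj Sj')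
Separates-applySign minus (inj₂ above) = inj₁ λ j j' Sj Sj' → opposite-<⁻¹ (above j j' Sj Sj')

inseparable-symDiagram : (s : SignedPerm3) (π : DPerm 3 k) → Inseparable (bar π) → Inseparable (symDiagram s π)
inseparable-symDiagram s π π-insep S (marked , unmarked , sep) = π-insep S (marked , unmarked , sep-π)
  where
  open SignedPerm3 s
  sep-π : ∀ w → Separates (bar π w) S
  sep-π w with proj₂ isPerm w
  ... | r , perm-r≡w = subst (λ w' → Separates (bar π w') S) (perm-r≡w refl) (Separates-applySign (sign r) (sep r))

inseparable-132-213 : Inseparable (bar p132-213)
inseparable-132-213 = vectors⇒inseparable (from-yes (inseparable? (bar p132-213)))

nonconstant-symDiagram : (s : SignedPerm3) → Nonconstant (symDiagram s p132-213)
nonconstant-symDiagram s = zero , zero , suc zero ,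
  first-two-differ (SignedPerm3.sign s zero) (SignedPerm3.perm s zero)
  where
  first-two-differ : ∀ sg w → applySign sg (bar p132-213 w zero) ≢ applySign sg (bar p132-213 w (suc zero))
  first-two-differ plus  zero             ()
  first-two-differ plus  (suc zero)       ()
  first-two-differ plus  (suc (suc zero)) ()
  first-two-differ minus zero             ()
  first-two-differ minus (suc zero)       ()
  first-two-differ minus (suc (suc zero)) ()

classical⇒diagram : (σ : DPerm d n) (i : Fin (pred d)) {p : RawPerm k} →
  ContainsClassical (comp σ i) p → ContainsDiagram σ (classicalDiagram p)
classical⇒diagram {d} σ i {p} (f , f-inc , p≅σᵢ) = ι , ι-inc , f , p≅σ
  where
  ι : Fin 2 → Fin (suc (pred d))
  ι zero    = zero
  ι (suc _) = suc i
  ι-inc : StrictlyIncreasing ι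
  ι-inc = <-pairs {R = λ a b → ι a F.< ι b} (λ { zero → s≤s z≤n }) no-pairs
  p≅σ : ∀ c j j' →
    (classicalDiagram p c j F.< classicalDiagram p c j') ⇔ (bar σ (ι c) (f j) F.< bar σ (ι c) (f j'))
  p≅σ zero       = strictlyIncreasing⇒<-⇔ f-inc
  p≅σ (suc zero) = p≅σᵢ

separable⇒avoids : {σ : DPerm d n} → Separable n σ →
  (∀ i → AvoidsClassical (comp σ i) p2413 × AvoidsClassical (comp σ i) p3142) × AvoidsSym132-213 σ
separable⇒avoids {σ = σ} sep =
  (λ i → avoids inseparable-2413 (nonconstant-classical p2413) ∘ classical⇒diagram σ i ,
         avoids inseparable-3142 (nonconstant-classical p3142) ∘ classical⇒diagram σ i) ,
  (λ s → avoids (inseparable-symDiagram s p132-213 inseparable-132-213) (nonconstant-symDiagram s))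
  where
  avoids : ∀ {D k} {P : Diagram D k} → Inseparable P → Nonconstant P → ¬ ContainsDiagram σ P
  avoids = separable⇒avoids-inseparable sep

-- The pairs pq, ps, rs share one colour and pr, qr, qs another: the colour
-- pattern of an occurrence of 2413 or 3142 at positions p < q < r < s.
AlternatingQuad : ∀ {I C : Set} → (I → I → C) → I → I → I → I → Set
AlternatingQuad col p q r s =
  col p q ≡ col p s × col p s ≡ col r s × col p r ≡ col q r × col q r ≡ col q s × col p q ≢ col p r

least-failure : (P : ℕ → Set) → (∀ x → Dec (P x)) → ∀ k →
  (∀ x → x ℕ.< k → P x) ⊎ ∃ λ a → a ℕ.< k × ¬ P a × (∀ x → x ℕ.< a → P x)
least-failure P P? zero = inj₁ λ _ ()
least-failure P P? (suc k) with least-failure P P? k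
... | inj₂ (a , a<k , ¬Pa , below) = inj₂ (a , NP.m<n⇒m<1+n a<k , ¬Pa , below)
... | inj₁ below-k with P? k
...   | yes Pk  = inj₁ λ x x<1+k → either (below-k x) (λ { refl → Pk }) (NP.m<1+n⇒m<n∨m≡n x<1+k)
...   | no  ¬Pk = inj₂ (k , NP.n<1+n k , ¬Pk , below-k)

module SplitPoint {C : Set} (_≟_ : DecidableEquality C) (col : ℕ → ℕ → C) (n : ℕ)
  (triangle : ∀ {p q r} → p ℕ.< q → q ℕ.< r → r ℕ.< n → col p q ≡ col p r ⊎ col p r ≡ col q r)
  (no-alternating : ∀ {p q r s} → p ℕ.< q → q ℕ.< r → r ℕ.< s → s ℕ.< n → ¬ AlternatingQuad col p q r s)
  where

  CrossColour : ℕ → ℕ → C → Set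
  CrossColour m k c = ∀ {x y} → x ℕ.< k → k ≤ y → y ℕ.< m → col x y ≡ c

  Split : ℕ → Set
  Split m = Σ ℕ λ k → Σ C λ c → 0 ℕ.< k × k ℕ.< m × CrossColour m k c

  module Deviation {m k a} {c : C} (m<n : m ℕ.< n) (k<m : k ℕ.< m) (cross : CrossColour m k c)
    (a<k : a ℕ.< k) (col-am≢c : col a m ≢ c) where

    agrees-right-of-k : ∀ {y} → k ≤ y → y ℕ.< m → col y m ≡ col a m
    agrees-right-of-k k≤y y<m with triangle (NP.<-≤-trans a<k k≤y) y<m m<n
    ... | inj₁ col-ay≡col-am = ⊥-elim (col-am≢c (trans (sym col-ay≡col-am) (cross a<k k≤y y<m)))
    ... | inj₂ col-am≡col-ym = sym col-am≡col-ym

    differs-from-a : ∀ {q} → a ≤ q → q ℕ.< m → col q m ≢ c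
    differs-from-a {q} a≤q q<m col-qm≡c with k ℕ.≤? q | NP.m≤n⇒m<n∨m≡n a≤q
    ... | yes k≤q | _           = col-am≢c (trans (sym (agrees-right-of-k k≤q q<m)) col-qm≡c)
    ... | no  _   | inj₂ refl   = col-am≢c col-qm≡c
    ... | no  k≰q | inj₁ a<q    = no-alternating a<q q<k k<m m<n
      (col-aq≡col-am , sym (agrees-right-of-k NP.≤-refl k<m) ,
       trans (cross a<k NP.≤-refl k<m) (sym (cross q<k NP.≤-refl k<m)) ,
       trans (cross q<k NP.≤-refl k<m) (sym col-qm≡c) ,
       λ col-aq≡col-ak → col-am≢c (trans (sym col-aq≡col-am) (trans col-aq≡col-ak (cross a<k NP.≤-refl k<m))))
      where
      q<k = NP.≰⇒> k≰q
      col-aq≡col-am : col a q ≡ col a m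
      col-aq≡col-am with triangle a<q q<m m<n
      ... | inj₁ e = e
      ... | inj₂ col-am≡col-qm = ⊥-elim (col-am≢c (trans col-am≡col-qm col-qm≡c))

    agrees-from-a : ∀ {x} → a ≤ x → x ℕ.< m → col x m ≡ col a m
    agrees-from-a {x} a≤x x<m with k ℕ.≤? x
    ... | yes k≤x = agrees-right-of-k k≤x x<m
    ... | no  k≰x with triangle (NP.≰⇒> k≰x) k<m m<n
    ...   | inj₁ col-xk≡col-xm =
      ⊥-elim (differs-from-a a≤x x<m (trans (sym col-xk≡col-xm) (cross (NP.≰⇒> k≰x) NP.≤-refl k<m)))
    ...   | inj₂ col-xm≡col-km = trans col-xm≡col-km (agrees-right-of-k NP.≤-refl k<m)

  -- If some point left of k sees the new point m in a colour other than c, the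
  -- least such point a becomes the new split point, or m does when a = 0.
  extend : ∀ {m} → m ℕ.< n → Split m → Split (suc m)
  extend {m} m<n (k , c , 0<k , k<m , cross) with least-failure (λ x → col x m ≡ c) (λ x → col x m ≟ c) k
  ... | inj₁ left-sees-c = k , c , 0<k , NP.m<n⇒m<1+n k<m , cross′
    where
    cross′ : CrossColour (suc m) k c
    cross′ x<k k≤y y<1+m with NP.m<1+n⇒m<n∨m≡n y<1+m
    ... | inj₁ y<m  = cross x<k k≤y y<m
    ... | inj₂ refl = left-sees-c _ x<k
  ... | inj₂ (zero , 0<k′ , col-0m≢c , _) = m , col 0 m , NP.<-trans 0<k k<m , NP.n<1+n m , cross′
    where
    open Deviation m<n k<m cross 0<k′ col-0m≢c
    cross′ : CrossColour (suc m) m (col 0 m)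
    cross′ x<m m≤y y<1+m rewrite NP.≤-antisym (NP.≤-pred y<1+m) m≤y = agrees-from-a z≤n x<m
  ... | inj₂ (suc a , a<k , col-am≢c , left-of-a) =
    suc a , c , s≤s z≤n , NP.<-trans a<k (NP.m<n⇒m<1+n k<m) , cross′
    where
    open Deviation m<n k<m cross a<k col-am≢c
    cross′ : CrossColour (suc m) (suc a) c
    cross′ {p} {q} p<a a≤q q<1+m with NP.m<1+n⇒m<n∨m≡n q<1+m
    ... | inj₂ refl = left-of-a p p<a
    ... | inj₁ q<m with triangle (NP.<-≤-trans p<a a≤q) q<m m<n
    ...   | inj₁ col-pq≡col-pm = trans col-pq≡col-pm (left-of-a p p<a)
    ...   | inj₂ col-pm≡col-qm = ⊥-elim (differs-from-a a≤q q<m (trans (sym col-pm≡col-qm) (left-of-a p p<a)))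

  split : ∀ m → 2 ≤ m → m ≤ n → Split m
  split (suc zero)          (s≤s ()) _
  split (suc (suc zero))    _ _   = 1 , col 0 1 , s≤s z≤n , s≤s (s≤s z≤n) , cross
    where
    cross : CrossColour 2 1 (col 0 1)
    cross {zero} {suc zero} _ _ _ = refl
    cross {zero} {suc (suc _)} _ _ (s≤s (s≤s ()))
    cross {suc _} (s≤s ()) _ _
  split (suc (suc (suc m))) _ 3+m≤n = extend 3+m≤n (split (suc (suc m)) (s≤s (s≤s z≤n)) (NP.<⇒≤ 3+m≤n))

Triangle : ∀ {C : Set} → (Fin n → Fin n → C) → Set
Triangle col = ∀ {p q r} → p F.< q → q F.< r → col p q ≡ col p r ⊎ col p r ≡ col q r

NoAlternatingQuad : ∀ {C : Set} → (Fin n → Fin n → C) → Set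
NoAlternatingQuad col = ∀ {p q r s} → p F.< q → q F.< r → r F.< s → ¬ AlternatingQuad col p q r s

CrossColourAt : ∀ {C : Set} → (Fin n → Fin n → C) → ℕ → C → Set
CrossColourAt col k c = ∀ x y → toℕ x ℕ.< k → k ≤ toℕ y → col x y ≡ c

clamp : ℕ → Fin (suc n)
clamp {zero}  _       = zero
clamp {suc n} zero    = zero
clamp {suc n} (suc x) = suc (clamp x)

toℕ-clamp : ∀ x → x ≤ n → toℕ (clamp {n} x) ≡ x
toℕ-clamp {zero}  zero    _         = refl
toℕ-clamp {suc n} zero    _         = refl
toℕ-clamp {suc n} (suc x) (s≤s x≤n) = cong suc (toℕ-clamp x x≤n)

clamp-toℕ : (i : Fin (suc n)) → clamp (toℕ i) ≡ i
clamp-toℕ {zero}  zero    = refl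
clamp-toℕ {suc n} zero    = refl
clamp-toℕ {suc n} (suc i) = cong suc (clamp-toℕ i)

clamp-< : ∀ {p q} → p ℕ.< q → q ℕ.< suc n → clamp {n} p F.< clamp q
clamp-< p<q q<1+n = subst₂ ℕ._<_
  (sym (toℕ-clamp _ (NP.≤-pred (NP.<-trans p<q q<1+n)))) (sym (toℕ-clamp _ (NP.≤-pred q<1+n))) p<q

split-point : ∀ {C : Set} → DecidableEquality C → (col : Fin (suc (suc n)) → Fin (suc (suc n)) → C) →
  Triangle col → NoAlternatingQuad col →
  Σ ℕ λ k → 0 ℕ.< k × k ℕ.< suc (suc n) × Σ C (CrossColourAt col k)
split-point {n} _≟_ col triangle no-alternating with
  SplitPoint.split _≟_ (λ x y → col (clamp x) (clamp y)) (suc (suc n))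
    (λ p<q q<r r<n → triangle (clamp-< p<q (NP.<-trans q<r r<n)) (clamp-< q<r r<n))
    (λ p<q q<r r<s s<n → no-alternating (clamp-< p<q (NP.<-trans q<r (NP.<-trans r<s s<n)))
      (clamp-< q<r (NP.<-trans r<s s<n)) (clamp-< r<s s<n))
    (suc (suc n)) (s≤s (s≤s z≤n)) NP.≤-refl
... | k , c , 0<k , k<n , cross = k , 0<k , k<n , c , λ x y x<k k≤y →
  subst₂ (λ u v → col u v ≡ c) (clamp-toℕ x) (clamp-toℕ y) (cross x<k k≤y (FP.toℕ<n y))

Triple : Set
Triple = Bool × Bool × Bool

b₁₂ b₁₃ b₂₃ : Triple → Bool
b₁₂ = proj₁
b₁₃ = proj₁ ∘ proj₂
b₂₃ = proj₂ ∘ proj₂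

triple : ∀ {m} → (Fin n → Fin m) → Fin n → Fin n → Fin n → Triple
triple f p q r = f p <ᵇ f q , f p <ᵇ f r , f q <ᵇ f r

Realizable : Triple → Set
Realizable (true  , false , true)  = ⊥
Realizable (false , true  , false) = ⊥
Realizable _                       = ⊤

triple-realizable : ∀ {m} (f : Fin n → Fin m) → Injective _≡_ _≡_ f →
  ∀ {p q r} → p F.< q → q F.< r → Realizable (triple f p q r)
triple-realizable f f-inj {p} {q} {r} p<q q<r with f p <ᵇ f q in b₁ | f p <ᵇ f r in b₂ | f q <ᵇ f r in b₃
... | true  | true  | _     = tt
... | false | false | _     = tt
... | true  | false | false = tt
... | false | true  | true  = tt
... | true  | false | true  =
  <ᵇ≡false⇒≮ {x = f p} {f r} b₂ (FP.<-trans (<ᵇ⇒< {x = f p} {f q} b₁) (<ᵇ⇒< {x = f q} {f r} b₃))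
... | false | true  | false =
  FP.<-asym (<ᵇ⇒< {x = f p} {f r} b₂) (FP.<-trans (descends q r b₃ q<r) (descends p q b₁ p<q))
  where
  descends : ∀ x y → f x <ᵇ f y ≡ false → x F.< y → f y F.< f x
  descends x y fx≮fy x<y = ≮∧≢⇒> (<ᵇ≡false⇒≮ {x = f x} {f y} fx≮fy) (FP.<⇒≢ x<y ∘ f-inj)

data MiddleFirst : Set where
  ⟨213⟩ ⟨231⟩ : MiddleFirst

data MiddleLast : Set where
  ⟨132⟩ ⟨312⟩ : MiddleLast

middleFirst : MiddleFirst → Triple
middleFirst ⟨213⟩ = false , true  , true
middleFirst ⟨231⟩ = true  , false , false

middleLast : MiddleLast → Triple
middleLast ⟨132⟩ = true  , true  , false
middleLast ⟨312⟩ = false , false , true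

classify-middleFirst : ∀ t → Realizable t → b₁₂ t ≢ b₁₃ t → Σ MiddleFirst λ X → t ≡ middleFirst X
classify-middleFirst (true  , false , false) _ _  = ⟨231⟩ , refl
classify-middleFirst (false , true  , true)  _ _  = ⟨213⟩ , refl
classify-middleFirst (true  , true  , _)     _ ne = ⊥-elim (ne refl)
classify-middleFirst (false , false , _)     _ ne = ⊥-elim (ne refl)

classify-middleLast : ∀ t → Realizable t → b₁₃ t ≢ b₂₃ t → Σ MiddleLast λ Y → t ≡ middleLast Y
classify-middleLast (true  , true  , false) _ _  = ⟨132⟩ , refl
classify-middleLast (false , false , true)  _ _  = ⟨312⟩ , refl
classify-middleLast (_     , true  , true)  _ ne = ⊥-elim (ne refl)
classify-middleLast (_     , false , false) _ ne = ⊥-elim (ne refl)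

no-zigzag : ∀ t → Realizable t → b₁₂ t ≢ b₁₃ t → b₁₃ t ≢ b₂₃ t → ⊥
no-zigzag (true  , true  , _)     _ ne _  = ne refl
no-zigzag (false , false , _)     _ ne _  = ne refl
no-zigzag (_     , true  , true)  _ _  ne = ne refl
no-zigzag (_     , false , false) _ _  ne = ne refl

rowTriple : ∀ {m} → (Fin 3 → Fin m) → Triple
rowTriple R = triple R zero (suc zero) (suc (suc zero))

increasing : Triple
increasing = true , true , true

swap₁₂ : Fin 3 → Fin 3
swap₁₂ zero             = zero
swap₁₂ (suc zero)       = suc (suc zero)
swap₁₂ (suc (suc zero)) = suc zero

swap₁₂-involutive : ∀ x → swap₁₂ (swap₁₂ x) ≡ x
swap₁₂-involutive zero             = refl
swap₁₂-involutive (suc zero)       = refl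
swap₁₂-involutive (suc (suc zero)) = refl

signs : Sign → Sign → Fin 3 → Sign
signs s₁ s₂ zero             = plus
signs s₁ s₂ (suc zero)       = s₁
signs s₁ s₂ (suc (suc zero)) = s₂

signedIdentity : Sign → Sign → SignedPerm3
signedIdentity s₁ s₂ = record
  { perm = λ x → x ; isPerm = (λ e → e) , (λ y → y , λ e → e) ; sign = signs s₁ s₂ }

signedSwap : Sign → Sign → SignedPerm3
signedSwap s₁ s₂ = record
  { perm   = swap₁₂
  ; isPerm = (λ {x} {y} e → trans (sym (swap₁₂-involutive x)) (trans (cong swap₁₂ e) (swap₁₂-involutive y)))
           , (λ y → swap₁₂ y , λ e → trans (cong swap₁₂ e) (swap₁₂-involutive y))
  ; sign   = signs s₁ s₂ }

HasRows : SignedPerm3 → Triple → Triple → Set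
HasRows s X Y = rowTriple (S zero) ≡ increasing × rowTriple (S (suc zero)) ≡ X × rowTriple (S (suc (suc zero))) ≡ Y
  where S = symDiagram s p132-213

symmetry-first-last : (X : MiddleFirst) (Y : MiddleLast) → Σ SignedPerm3 λ s → HasRows s (middleFirst X) (middleLast Y)
symmetry-first-last ⟨213⟩ ⟨132⟩ = signedSwap plus  plus  , refl , refl , refl
symmetry-first-last ⟨213⟩ ⟨312⟩ = signedSwap plus  minus , refl , refl , refl
symmetry-first-last ⟨231⟩ ⟨132⟩ = signedSwap minus plus  , refl , refl , refl
symmetry-first-last ⟨231⟩ ⟨312⟩ = signedSwap minus minus , refl , refl , refl

symmetry-last-first : (Y : MiddleLast) (X : MiddleFirst) → Σ SignedPerm3 λ s → HasRows s (middleLast Y) (middleFirst X)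
symmetry-last-first ⟨132⟩ ⟨213⟩ = signedIdentity plus  plus  , refl , refl , refl
symmetry-last-first ⟨132⟩ ⟨231⟩ = signedIdentity plus  minus , refl , refl , refl
symmetry-last-first ⟨312⟩ ⟨213⟩ = signedIdentity minus plus  , refl , refl , refl
symmetry-last-first ⟨312⟩ ⟨231⟩ = signedIdentity minus minus , refl , refl , refl

colour : DPerm d n → Fin n → Fin n → Vec Bool (pred d)
colour σ x y = tabulate λ i → comp σ i x <ᵇ comp σ i y

InjectiveComps : DPerm d n → Set
InjectiveComps σ = ∀ i → Injective _≡_ _≡_ (comp σ i)

tabulate-≢ : ∀ {m} {f g : Fin m → Bool} → tabulate f ≢ tabulate g → ∃ λ i → f i ≢ g i
tabulate-≢ {m} {f} {g} f≢g = FP.¬∀⟶∃¬ m (λ i → f i ≡ g i) (λ i → f i Bool.≟ g i) (f≢g ∘ VP.tabulate-cong)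

pairs₃ : {R : Fin 3 → Fin 3 → Set} → R zero (suc zero) → R zero (suc (suc zero)) → R (suc zero) (suc (suc zero)) →
  ∀ j j' → j F.< j' → R j j'
pairs₃ r₀₁ r₀₂ r₁₂ = <-pairs (λ { zero → r₀₁ ; (suc zero) → r₀₂ }) (<-pairs (λ { zero → r₁₂ }) no-pairs)

pairs₄ : {R : Fin 4 → Fin 4 → Set} →
  R zero (suc zero) → R zero (suc (suc zero)) → R zero (suc (suc (suc zero))) →
  R (suc zero) (suc (suc zero)) → R (suc zero) (suc (suc (suc zero))) → R (suc (suc zero)) (suc (suc (suc zero))) →
  ∀ j j' → j F.< j' → R j j'
pairs₄ r₀₁ r₀₂ r₀₃ r₁₂ r₁₃ r₂₃ =
  <-pairs (λ { zero → r₀₁ ; (suc zero) → r₀₂ ; (suc (suc zero)) → r₀₃ })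
    (<-pairs (λ { zero → r₁₂ ; (suc zero) → r₁₃ }) (<-pairs (λ { zero → r₂₃ }) no-pairs))

increasing₃ : ∀ {p q r : Fin n} → p F.< q → q F.< r → StrictlyIncreasing (lookup (p ∷ q ∷ r ∷ []))
increasing₃ {p = p} {q} {r} p<q q<r = pairs₃ {R = λ a b → g a F.< g b} p<q (FP.<-trans p<q q<r) q<r
  where g = lookup (p ∷ q ∷ r ∷ [])

increasing₄ : ∀ {p q r s : Fin n} → p F.< q → q F.< r → r F.< s →
  StrictlyIncreasing (lookup (p ∷ q ∷ r ∷ s ∷ []))
increasing₄ {p = p} {q} {r} {s} p<q q<r r<s = pairs₄ {R = λ a b → g a F.< g b}
  p<q (FP.<-trans p<q q<r) (FP.<-trans (FP.<-trans p<q q<r) r<s) q<r (FP.<-trans q<r r<s) r<s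
  where g = lookup (p ∷ q ∷ r ∷ s ∷ [])

bits-agree₃ : ∀ {m m'} (R : Fin 3 → Fin m) (f : Fin 3 → Fin m') → rowTriple R ≡ rowTriple f →
  ∀ j j' → j F.< j' → R j <ᵇ R j' ≡ f j <ᵇ f j'
bits-agree₃ _ _ e = pairs₃ (cong b₁₂ e) (cong b₁₃ e) (cong b₂₃ e)

injective? : ∀ {m} (f : Fin k → Fin m) → Dec (∀ x y → f x ≡ f y → x ≡ y)
injective? f = FP.all? λ x → FP.all? λ y → (f x FP.≟ f y) →-dec (x FP.≟ y)

applySign-injective : ∀ sg → Injective _≡_ _≡_ (applySign {n} sg)
applySign-injective plus  e = e
applySign-injective minus = opposite-injective

symDiagram-injective : (s : SignedPerm3) → ∀ c → Injective _≡_ _≡_ (symDiagram s p132-213 c)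
symDiagram-injective s c =
  p132-213-injective (SignedPerm3.perm s c) _ _ ∘ applySign-injective (SignedPerm3.sign s c)
  where
  p132-213-injective : ∀ w x y → bar p132-213 w x ≡ bar p132-213 w y → x ≡ y
  p132-213-injective = from-yes (FP.all? λ w → injective? (bar p132-213 w))

module Axioms {d n} (σ : DPerm d n) (σ-inj : InjectiveComps σ) where

  bar-injective : ∀ w → Injective _≡_ _≡_ (bar σ w)
  bar-injective zero    e = e
  bar-injective (suc i) e = σ-inj i e

  occurrence-from-bits : ∀ {D k} {P : Diagram D k} → (∀ c → Injective _≡_ _≡_ (P c)) →
    (ι : Fin D → Fin (suc (pred d))) → StrictlyIncreasing ι → (g : Fin k → Fin n) → StrictlyIncreasing g →
    (∀ c j j' → j F.< j' → P c j <ᵇ P c j' ≡ bar σ (ι c) (g j) <ᵇ bar σ (ι c) (g j')) → ContainsDiagram σ P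
  occurrence-from-bits {P = P} P-inj ι ι-inc g g-inc bits = ι , ι-inc , g , λ c →
    <-⇔-from-bits (P c) (bar σ (ι c) ∘ g) (P-inj c)
      (strictlyIncreasing⇒injective g-inc ∘ bar-injective (ι c)) (bits c)

  classical-from-bits : ∀ {i k} {p : RawPerm k} → Injective _≡_ _≡_ p → (g : Fin k → Fin n) → StrictlyIncreasing g →
    (∀ j j' → j F.< j' → p j <ᵇ p j' ≡ comp σ i (g j) <ᵇ comp σ i (g j')) → ContainsClassical (comp σ i) p
  classical-from-bits {i} {p = p} p-inj g g-inc bits = g , g-inc ,
    <-⇔-from-bits p (comp σ i ∘ g) p-inj (strictlyIncreasing⇒injective g-inc ∘ σ-inj i) bits

  sym-occurrence : ∀ s {u v p q r} → u F.< v → p F.< q → q F.< r →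
    HasRows s (triple (comp σ u) p q r) (triple (comp σ v) p q r) → ContainsDiagram σ (symDiagram s p132-213)
  sym-occurrence s {u} {v} {p} {q} {r} u<v p<q q<r (row₀ , row₁ , row₂) =
    occurrence-from-bits (symDiagram-injective s) ι ι-inc g (increasing₃ p<q q<r)
      (λ c → bits-agree₃ (symDiagram s p132-213 c) (bar σ (ι c) ∘ g) (rows c))
    where
    ι : Fin 3 → Fin (suc (pred d))
    ι = lookup (zero ∷ suc u ∷ suc v ∷ [])
    ι-inc : StrictlyIncreasing ι
    ι-inc = pairs₃ {R = λ a b → ι a F.< ι b} (s≤s z≤n) (s≤s z≤n) (s≤s u<v)
    g : Fin 3 → Fin n
    g = lookup (p ∷ q ∷ r ∷ [])
    g-increasing : rowTriple g ≡ increasing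
    g-increasing = cong₂ _,_ (<⇒<ᵇ p<q) (cong₂ _,_ (<⇒<ᵇ (FP.<-trans p<q q<r)) (<⇒<ᵇ q<r))
    rows : ∀ c → rowTriple (symDiagram s p132-213 c) ≡ rowTriple (bar σ (ι c) ∘ g)
    rows zero             = trans row₀ (sym g-increasing)
    rows (suc zero)       = row₁
    rows (suc (suc zero)) = row₂

  bit : Fin (pred d) → Fin n → Fin n → Bool
  bit i x y = comp σ i x <ᵇ comp σ i y

  alternating-occurrence : ∀ i {p q r s} → p F.< q → q F.< r → r F.< s → ∀ α →
    bit i p q ≡ α → bit i p r ≡ Bool.not α → bit i p s ≡ α →
    bit i q r ≡ Bool.not α → bit i q s ≡ Bool.not α → bit i r s ≡ α →
    ContainsClassical (comp σ i) (if α then p2413 else p3142)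
  alternating-occurrence i p<q q<r r<s true pq pr ps qr qs rs =
    classical-from-bits (λ {x} {y} → from-yes (injective? p2413) x y) _ (increasing₄ p<q q<r r<s)
      (pairs₄ (sym pq) (sym pr) (sym ps) (sym qr) (sym qs) (sym rs))
  alternating-occurrence i p<q q<r r<s false pq pr ps qr qs rs =
    classical-from-bits (λ {x} {y} → from-yes (injective? p3142) x y) _ (increasing₄ p<q q<r r<s)
      (pairs₄ (sym pq) (sym pr) (sym ps) (sym qr) (sym qs) (sym rs))

  bit-≡ : ∀ i {x y x' y'} → colour σ x y ≡ colour σ x' y' → bit i x y ≡ bit i x' y'
  bit-≡ i e = trans (sym (VP.lookup∘tabulate _ i)) (trans (cong (λ V → lookup V i) e) (VP.lookup∘tabulate _ i))

  no-alternating : (∀ i → AvoidsClassical (comp σ i) p2413 × AvoidsClassical (comp σ i) p3142) →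
    NoAlternatingQuad (colour σ)
  no-alternating avoids {p} {q} {r} {s} p<q q<r r<s (pq≡ps , ps≡rs , pr≡qr , qr≡qs , pq≢pr)
    with tabulate-≢ pq≢pr
  ... | i , bit-pq≢pr = avoid-both (bit i p q)
    (alternating-occurrence i p<q q<r r<s (bit i p q) refl pr ps qr qs rs)
    where
    ps = sym (bit-≡ i pq≡ps)
    rs = trans (sym (bit-≡ i ps≡rs)) ps
    pr = BoolP.¬-not (bit-pq≢pr ∘ sym)
    qr = trans (sym (bit-≡ i pr≡qr)) pr
    qs = trans (sym (bit-≡ i qr≡qs)) qr
    avoid-both : ∀ α → ¬ ContainsClassical (comp σ i) (if α then p2413 else p3142)
    avoid-both true  = proj₁ (avoids i)
    avoid-both false = proj₂ (avoids i)

  triangle : AvoidsSym132-213 σ → Triangle (colour σ)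
  triangle avoids {p} {q} {r} p<q q<r
    with VP.≡-dec Bool._≟_ (colour σ p q) (colour σ p r) | VP.≡-dec Bool._≟_ (colour σ p r) (colour σ q r)
  ... | yes pq≡pr | _         = inj₁ pq≡pr
  ... | no _      | yes pr≡qr = inj₂ pr≡qr
  ... | no pq≢pr  | no pr≢qr  = ⊥-elim (mixed (tabulate-≢ pq≢pr) (tabulate-≢ pr≢qr))
    where
    t : Fin (pred d) → Triple
    t i = triple (comp σ i) p q r
    realizable : ∀ i → Realizable (t i)
    realizable i = triple-realizable (comp σ i) (σ-inj i) p<q q<r
    -- A coordinate separating col p q from col p r and one separating col p r from col q r,
    -- read together with the identity coordinate, form a symmetry of (132,213).
    mixed : (∃ λ i → b₁₂ (t i) ≢ b₁₃ (t i)) → (∃ λ i → b₁₃ (t i) ≢ b₂₃ (t i)) → ⊥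
    mixed (i , first≢) (i' , last≢)
      with FP.<-cmp i i' | classify-middleFirst (t i) (realizable i) first≢
         | classify-middleLast (t i') (realizable i') last≢
    ... | tri< i<i' _ _ | X , tᵢ≡X | Y , tᵢ'≡Y with symmetry-first-last X Y
    ...   | s , rows = avoids s (sym-occurrence s i<i' p<q q<r (subst₂ (HasRows s) (sym tᵢ≡X) (sym tᵢ'≡Y) rows))
    mixed (i , first≢) (i' , last≢) | tri> _ _ i'<i | X , tᵢ≡X | Y , tᵢ'≡Y with symmetry-last-first Y X
    ...   | s , rows = avoids s (sym-occurrence s i'<i p<q q<r (subst₂ (HasRows s) (sym tᵢ'≡Y) (sym tᵢ≡X) rows))
    mixed (i , first≢) (i' , last≢) | tri≈ _ refl _ | _ | _ = no-zigzag (t i) (realizable i) first≢ last≢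

count-below : ∀ {K M N} (A : Fin K → Fin N) (B : Fin M → Fin N) → Injective _≡_ _≡_ A →
  (∀ i j → A i F.< B j) → ∀ j → K ≤ toℕ (B j)
count-below A B A-inj A<B j = FP.injective⇒≤ {f = λ i → fromℕ< (A<B i j)} λ e →
  A-inj (FP.toℕ-injective (trans (sym (FP.toℕ-fromℕ< (A<B _ j))) (trans (cong toℕ e) (FP.toℕ-fromℕ< (A<B _ j)))))

separated-values : ∀ {K M N} (A : Fin K → Fin N) (B : Fin M → Fin N) →
  Injective _≡_ _≡_ A → Injective _≡_ _≡_ B → (∀ i j → A i F.< B j) → K + M ≡ N →
  (∀ i → toℕ (A i) ℕ.< K) × (∀ j → K ≤ toℕ (B j))
separated-values {K} {M} {N} A B A-inj B-inj A<B K+M≡N = A-low , count-below A B A-inj A<B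
  where
  -- the M values of B lie strictly between A i and N
  room-above : ∀ i → M ≤ N ∸ suc (toℕ (A i))
  room-above i = subst (M ≤_) (FP.opposite-prop (A i))
    (count-below (opposite ∘ B) (opposite ∘ A) (B-inj ∘ opposite-injective) (λ j i → opposite-< (A<B i j)) i)
  A-low : ∀ i → toℕ (A i) ℕ.< K
  A-low i = NP.+-cancelʳ-≤ M (suc (toℕ (A i))) K (begin
    suc (toℕ (A i)) + M             ≤⟨ NP.+-monoʳ-≤ (suc (toℕ (A i))) (room-above i) ⟩
    suc (toℕ (A i)) + (N ∸ suc (toℕ (A i))) ≡⟨ NP.m+[n∸m]≡n (FP.toℕ<n (A i)) ⟩
    N                               ≡⟨ sym K+M≡N ⟩
    K + M                           ∎)
    where open NP.≤-Reasoning

window : ∀ {N} (o L : ℕ) (v : Fin N) → o ≤ toℕ v × toℕ v ℕ.< o + L → Σ (Fin L) λ w → toℕ v ≡ o + toℕ w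
window o L v (o≤v , v<o+L) =
  fromℕ< v∸o<L , trans (sym (NP.m+[n∸m]≡n o≤v)) (cong (o +_) (sym (FP.toℕ-fromℕ< v∸o<L)))
  where
  v∸o<L : toℕ v ∸ o ℕ.< L
  v∸o<L = subst (toℕ v ∸ o ℕ.<_) (NP.m+n∸m≡n o L) (NP.∸-monoˡ-< v<o+L o≤v)

↑ˡ-increasing : ∀ {k} m → StrictlyIncreasing {k} (_↑ˡ m)
↑ˡ-increasing m x x' x<x' = subst₂ ℕ._<_ (sym (FP.toℕ-↑ˡ x m)) (sym (FP.toℕ-↑ˡ x' m)) x<x'

↑ʳ-increasing : ∀ {m} k → StrictlyIncreasing {m} (k ↑ʳ_)
↑ʳ-increasing k y y' y<y' = subst₂ ℕ._<_ (sym (FP.toℕ-↑ʳ k y)) (sym (FP.toℕ-↑ʳ k y')) (NP.+-monoʳ-< k y<y')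

↑ˡ≢↑ʳ : ∀ {k m} (x : Fin k) (y : Fin m) → x ↑ˡ m ≢ k ↑ʳ y
↑ˡ≢↑ʳ {k} {m} x y e = NP.<-irrefl (cong toℕ e)
  (subst₂ ℕ._<_ (sym (FP.toℕ-↑ˡ x m)) (sym (FP.toℕ-↑ʳ k y)) (NP.<-≤-trans (FP.toℕ<n x) (NP.m≤m+n k (toℕ y))))

Triangle-restrict : ∀ {C : Set} {col : Fin n → Fin n → C} {col' : Fin k → Fin k → C} (h : Fin k → Fin n) →
  StrictlyIncreasing h → (∀ x y → col' x y ≡ col (h x) (h y)) → Triangle col → Triangle col'
Triangle-restrict h h-inc col'≡col tri {p} {q} {r} p<q q<r
  rewrite col'≡col p q | col'≡col p r | col'≡col q r = tri (h-inc _ _ p<q) (h-inc _ _ q<r)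

NoAlternatingQuad-restrict : ∀ {C : Set} {col : Fin n → Fin n → C} {col' : Fin k → Fin k → C} (h : Fin k → Fin n) →
  StrictlyIncreasing h → (∀ x y → col' x y ≡ col (h x) (h y)) → NoAlternatingQuad col → NoAlternatingQuad col'
NoAlternatingQuad-restrict h h-inc col'≡col no-alt {p} {q} {r} {s} p<q q<r r<s
  rewrite col'≡col p q | col'≡col p r | col'≡col p s | col'≡col q r | col'≡col q s | col'≡col r s =
  no-alt (h-inc _ _ p<q) (h-inc _ _ q<r) (h-inc _ _ r<s)

module Decompose {d} (k m : ℕ) (τ : DPerm d (k + m)) (τ-inj : InjectiveComps τ) (c : Vec Bool (pred d))
  (cross : CrossColourAt (colour τ) k c) where

  L : Fin (pred d) → Fin k → Fin (k + m)
  L i x = comp τ i (x ↑ˡ m)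

  R : Fin (pred d) → Fin m → Fin (k + m)
  R i y = comp τ i (k ↑ʳ y)

  cross-bit : ∀ i x y → L i x <ᵇ R i y ≡ lookup c i
  cross-bit i x y = trans (sym (VP.lookup∘tabulate _ i)) (cong (λ V → lookup V i) (cross _ _
    (subst (ℕ._< k) (sym (FP.toℕ-↑ˡ x m)) (FP.toℕ<n x))
    (subst (k ≤_) (sym (FP.toℕ-↑ʳ k y)) (NP.m≤m+n k (toℕ y)))))

  sign : Fin (suc (pred d)) → Sign
  sign zero    = plus
  sign (suc i) = if lookup c i then plus else minus

  direction : Direction d
  direction = sign , refl

  L-injective : ∀ i → Injective _≡_ _≡_ (L i)
  L-injective i = FP.↑ˡ-injective m _ _ ∘ τ-inj i

  R-injective : ∀ i → Injective _≡_ _≡_ (R i)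
  R-injective i = FP.↑ʳ-injective k _ _ ∘ τ-inj i

  in-windows : ∀ i →
    (∀ x → leftOffset m (sign (suc i)) ≤ toℕ (L i x) × toℕ (L i x) ℕ.< leftOffset m (sign (suc i)) + k) ×
    (∀ y → rightOffset k (sign (suc i)) ≤ toℕ (R i y) × toℕ (R i y) ℕ.< rightOffset k (sign (suc i)) + m)
  in-windows i with lookup c i in cᵢ
  ... | true  = (λ x → z≤n , proj₁ sep x) , (λ y → proj₂ sep y , FP.toℕ<n (R i y))
    where
    sep = separated-values (L i) (R i) (L-injective i) (R-injective i)
      (λ x y → <ᵇ⇒< {x = L i x} {R i y} (trans (cross-bit i x y) cᵢ)) refl
  ... | false = (λ x → proj₂ sep x , subst (toℕ (L i x) ℕ.<_) (NP.+-comm k m) (FP.toℕ<n (L i x))) ,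
                (λ y → z≤n , proj₁ sep y)
    where
    R<L : ∀ y x → R i y F.< L i x
    R<L y x = ≮∧≢⇒> (<ᵇ≡false⇒≮ {x = L i x} {R i y} (trans (cross-bit i x y) cᵢ))
      (↑ˡ≢↑ʳ x y ∘ τ-inj i)
    sep = separated-values (R i) (L i) (R-injective i) (L-injective i) R<L (NP.+-comm m k)

  σ : DPerm d k
  σ = dperm λ i x → proj₁ (window _ k (L i x) (proj₁ (in-windows i) x))

  π : DPerm d m
  π = dperm λ i y → proj₁ (window _ m (R i y) (proj₂ (in-windows i) y))

  L-values : ∀ i x → toℕ (L i x) ≡ leftOffset m (sign (suc i)) + toℕ (comp σ i x)
  L-values i x = proj₂ (window _ k (L i x) (proj₁ (in-windows i) x))

  R-values : ∀ i y → toℕ (R i y) ≡ rightOffset k (sign (suc i)) + toℕ (comp π i y)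
  R-values i y = proj₂ (window _ m (R i y) (proj₂ (in-windows i) y))

  τ≗σ+π : ∀ i x → comp τ i x ≡ comp (dsum direction σ π) i x
  τ≗σ+π i = signedSum-unique (sign (suc i)) (comp τ i) (comp σ i) (comp π i) (L-values i) (R-values i)

  σ-injective : InjectiveComps σ
  σ-injective i {x} {x'} e = L-injective i (FP.toℕ-injective
    (trans (L-values i x) (trans (cong (λ z → leftOffset m (sign (suc i)) + toℕ z) e) (sym (L-values i x')))))

  π-injective : InjectiveComps π
  π-injective i {y} {y'} e = R-injective i (FP.toℕ-injective
    (trans (R-values i y) (trans (cong (λ z → rightOffset k (sign (suc i)) + toℕ z) e) (sym (R-values i y')))))

  colour-σ : ∀ x x' → colour σ x x' ≡ colour τ (x ↑ˡ m) (x' ↑ˡ m)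
  colour-σ x x' = VP.tabulate-cong λ i → sym (<ᵇ-shift _ {comp σ i x} {comp σ i x'} (L-values i x) (L-values i x'))

  colour-π : ∀ y y' → colour π y y' ≡ colour τ (k ↑ʳ y) (k ↑ʳ y')
  colour-π y y' = VP.tabulate-cong λ i → sym (<ᵇ-shift _ {comp π i y} {comp π i y'} (R-values i y) (R-values i y'))

AxiomsImplySeparable : ℕ → ℕ → Set
AxiomsImplySeparable d n = 1 ≤ n → (σ : DPerm d n) → InjectiveComps σ →
  Triangle (colour σ) → NoAlternatingQuad (colour σ) → Separable n σ

axioms⇒separable : ∀ n → AxiomsImplySeparable d n
axioms⇒separable {d} = <-rec (AxiomsImplySeparable d) step
  where
  sum-at-split : ∀ k m → 1 ≤ k → 1 ≤ m → (∀ {j} → j ℕ.< k + m → AxiomsImplySeparable d j) →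
    (τ : DPerm d (k + m)) → InjectiveComps τ → Triangle (colour τ) → NoAlternatingQuad (colour τ) →
    Σ _ (CrossColourAt (colour τ) k) → Separable (k + m) τ
  sum-at-split k m 1≤k 1≤m rec τ τ-inj tri no-alt (c , cross) = sep-sum direction
    (rec (NP.m<m+n k 1≤m) 1≤k σ σ-injective
      (Triangle-restrict (_↑ˡ m) (↑ˡ-increasing m) colour-σ tri)
      (NoAlternatingQuad-restrict (_↑ˡ m) (↑ˡ-increasing m) colour-σ no-alt))
    (rec (NP.m<n+m m 1≤k) 1≤m π π-injective
      (Triangle-restrict (k ↑ʳ_) (↑ʳ-increasing k) colour-π tri)
      (NoAlternatingQuad-restrict (k ↑ʳ_) (↑ʳ-increasing k) colour-π no-alt))
    τ τ≗σ+π
    where open Decompose k m τ τ-inj c cross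

  step : ∀ n → (∀ {j} → j ℕ.< n → AxiomsImplySeparable d j) → AxiomsImplySeparable d n
  step zero       _ ()
  step (suc zero) _ _ σ _ _ _ = sep-one σ λ i → (λ _ → fin1-unique _ _) , λ y → zero , λ _ → fin1-unique _ _
  step n@(suc (suc _)) rec _ σ σ-inj tri no-alt
    with split-point (VP.≡-dec Bool._≟_) (colour σ) tri no-alt
  ... | k , 0<k , k<n , cross = subst Goal (NP.m+[n∸m]≡n (NP.<⇒≤ k<n))
    (sum-at-split k (n ∸ k) 0<k (NP.m<n⇒0<n∸m k<n)) rec σ σ-inj tri no-alt cross
    where
    Goal : ℕ → Set
    Goal N = (∀ {j} → j ℕ.< N → AxiomsImplySeparable d j) → (τ : DPerm d N) → InjectiveComps τ →
      Triangle (colour τ) → NoAlternatingQuad (colour τ) → Σ _ (CrossColourAt (colour τ) k) → Separable N τ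

theorem2 : (d : ℕ) → 2 ≤ d → (n : ℕ) → 1 ≤ n →
    (σ : DPerm d n) → IsDPerm σ →
    Separable n σ ⇔
      ((∀ i → AvoidsClassical (comp σ i) p2413 × AvoidsClassical (comp σ i) p3142)
        × AvoidsSym132-213 σ)
theorem2 d _ n 1≤n σ σ-perm = mk⇔ separable⇒avoids λ (avoids-classical , avoids-sym) →
  axioms⇒separable n 1≤n σ σ-inj (triangle avoids-sym) (no-alternating avoids-classical)
  where
  σ-inj : InjectiveComps σ
  σ-inj i = proj₁ (σ-perm i)
  open Axioms σ σ-inj
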